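{- Let $G$ be a mixed graph and let $a,b\in V(G)$ be distinct vertices with $\vec{ab}\notin E(G)$ and $\vec{ba}\notin E(G)$. Then: (i) The map $f:V(G_b^a)\to V(G_a^b)$ with $f(b)=a$, $f(a)=b$ and $f(x)=x$ otherwise is a graph isomorphism from $G_b^a$ to $G_a^b$. (ii) In dictionary order, $d(G_b^a)\geq d(G)$. Moreover the following are equivalent: (a) $d(G_b^a)=d(G)$; (b) $G$ is isomorphic to $G_b^a$; (c) either $N^+_G(a)-\{b\}\subseteq N^+_G(b)-\{a\}$ and $N^-_G(a)-\{b\}\subseteq N^-_G(b)-\{a\}$, or $N^+_G(b)-\{a\}\subseteq N^+_G(a)-\{b\}$ and $N^-_G(b)-\{a\}\subseteq N^-_G(a)-\{b\}$.
   Context: A mixed graph on vertex set $[n]$ has, between any two distinct vertices, at most one of: an arc $\vec{ij}$, an undirected edge $ij$, or nothing; it is determined by its adjacency matrix $A=(a_{ij})$, where $a_{ij}=1$ iff $\vec{ij}\in E$ or $ij\in E$ (so $ij$ undirected iff $a_{ij}=a_{ji}=1$). $N^+_G(u)=\{v:\vec{uv}\in E(G)\text{ or }uv\in E(G)\}$, $N^-_G(u)=\{v:\vec{vu}\in E(G)\text{ or }uv\in E(G)\}$, and the degree of $u$ is $d_G(u)=|N^+_G(u)|+|N^-_G(u)|$. The degree sequence $d(G)$ is the list of degrees in descending order; sequences are compared in dictionary (lexicographic) order. For distinct $a,b$ with no arc between them (i.e. either $ab$ is an undirected edge or they are non-adjacent), the Kelmans transformation $G_b^a$ is the mixed graph with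 adjacency matrix $A'=(a'_{ij})$ given by: for $i\notin\{a,b\}$, $a'_{ia}=\max(a_{ia},a_{ib})$, $a'_{ib}=\min(a_{ia},a_{ib})$, $a'_{ai}=\max(a_{ai},a_{bi})$, $a'_{bi}=\min(a_{ai},a_{bi})$; all other entries (including $a'_{ab},a'_{ba}$ and entries with $i,j\notin\{a,b\}$) equal those of $A$. -}

module Defs where

open import Data.Nat using (ℕ; _≤_; _+_)
open import Data.Nat.Properties using (≤-decTotalOrder)
open import Data.Bool using (Bool; true; false; if_then_else_; _∨_; _∧_)
open import Data.Fin using (Fin; _≟_)
open import Data.List using (List; map; reverse; allFin)
open import Data.Nat.ListAction using (sum)
open import Data.List.Sort ≤-decTotalOrder using (sort)
open import Data.List.Relation.Binary.Lex.NonStrict using (Lex-≤)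
open import Data.Product using (Σ; _×_)
open import Function.Definitions using (Bijective)
open import Relation.Binary.PropositionalEquality using (_≡_)
open import Relation.Nullary using (yes; no; ¬_)

-- A mixed graph on vertex set Fin n is given by its 0/1 adjacency matrix
-- (true = 1), with zero diagonal.  a i j = a j i = true is an undirected
-- edge ij, exactly one of them true is an arc.
Adj : ℕ → Set
Adj n = Fin n → Fin n → Bool

record MixedGraph (n : ℕ) : Set where
  field
    adj      : Adj n
    loopless : ∀ i → adj i i ≡ false
open MixedGraph public

-- no arc between a and b: either undirected edge or non-adjacent
NoArc : ∀ {n} → Adj n → Fin n → Fin n → Set
NoArc A a b = A a b ≡ A b a

-- Kelmans transformation G_b^a (a receives the union, b the intersection)
kelmans : ∀ {n} → Adj n → Fin n → Fin n → Adj n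
kelmans A a b i j with i ≟ a | i ≟ b | j ≟ a | j ≟ b
... | yes _ | _     | yes _ | _     = A i j
... | yes _ | _     | no _  | yes _ = A i j
... | yes _ | _     | no _  | no _  = A a j ∨ A b j
... | no _  | yes _ | yes _ | _     = A i j
... | no _  | yes _ | no _  | yes _ = A i j
... | no _  | yes _ | no _  | no _  = A a j ∧ A b j
... | no _  | no _  | yes _ | _     = A i a ∨ A i b
... | no _  | no _  | no _  | yes _ = A i a ∧ A i b
... | no _  | no _  | no _  | no _  = A i j

kelmansG : ∀ {n} → MixedGraph n → Fin n → Fin n → Adj n
kelmansG G a b = kelmans (adj G) a b

ind : Bool → ℕ
ind true  = 1
ind false = 0

outdeg : ∀ {n} → Adj n → Fin n → ℕ
outdeg {n} A u = sum (map (λ v → ind (A u v)) (allFin n))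

indeg : ∀ {n} → Adj n → Fin n → ℕ
indeg {n} A u = sum (map (λ v → ind (A v u)) (allFin n))

degree : ∀ {n} → Adj n → Fin n → ℕ
degree A u = outdeg A u + indeg A u

degSeq : ∀ {n} → Adj n → List ℕ
degSeq {n} A = reverse (sort (map (degree A) (allFin n)))

_≤lex_ : List ℕ → List ℕ → Set
xs ≤lex ys = Lex-≤ _≡_ _≤_ xs ys

IsIsoMap : ∀ {n} → Adj n → Adj n → (Fin n → Fin n) → Set
IsIsoMap A B f = Bijective _≡_ _≡_ f × (∀ i j → A i j ≡ B (f i) (f j))

Isomorphic : ∀ {n} → Adj n → Adj n → Set
Isomorphic {n} A B = Σ (Fin n → Fin n) (IsIsoMap A B)

swapAB : ∀ {n} → Fin n → Fin n → Fin n → Fin n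
swapAB a b x with x ≟ b | x ≟ a
... | yes _ | _     = a
... | no _  | yes _ = b
... | no _  | no _  = x

OutSub : ∀ {n} → Adj n → Fin n → Fin n → Fin n → Fin n → Set
OutSub A u w v z = ∀ x → A u x ≡ true → ¬ x ≡ w → (A v x ≡ true × ¬ x ≡ z)

InSub : ∀ {n} → Adj n → Fin n → Fin n → Fin n → Fin n → Set
InSub A u w v z = ∀ x → A x u ≡ true → ¬ x ≡ w → (A x v ≡ true × ¬ x ≡ z)

-- Only the rows and columns of a and b change, and a vertex x ∉ {a, b} keeps its degree because
-- ind (p ∨ q) + ind (p ∧ q) = ind p + ind q. The new degree d′ of a dominates d(a), and, applied
-- to G_a^b ≅ G_b^a, also d(b). If d′ = d(a), the equality case of this domination gives
-- N(b) − a ⊆ N(a) − b, and then G_b^a is G itself; if d′ = d(b), symmetrically N(a) − b ⊆ N(b) − a,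
-- so G = G_a^b ≅ G_b^a via the swap of a and b. Otherwise the degrees d(a), d(b) are replaced by
-- d′ and some d″ where d′ exceeds both, which raises the descending degree sequence strictly in
-- dictionary order: inserting a common element into two descending lists preserves their
-- lexicographic order.

module Submission where

open import Defs
open import Data.Nat using (ℕ; _+_; _≤_; _<_; _≤?_; z≤n)
open import Data.Nat.ListAction using (sum)
open import Data.Nat.ListAction.Properties using (sum-↭)
open import Data.Nat.Properties using (≤-decTotalOrder; ≤-refl; ≤-reflexive; ≤-trans; ≤-antisym; <⇒≱; <⇒≤; <⇒≢; ≰⇒>; <-trans; ≤∧≢⇒<; +-mono-≤; +-monoˡ-≤; +-monoʳ-≤; +-cancelˡ-≤; +-cancelʳ-≤; +-assoc)
import Data.Nat.Properties as ℕ
open import Data.Bool using (true; false; _∨_; _∧_)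
open import Data.Bool.Properties using (∨-comm; ∧-comm)
open import Data.Empty using (⊥; ⊥-elim)
open import Data.Unit using (⊤)
open import Data.Fin using (Fin; _≟_)
open import Data.List using (List; []; _∷_; _++_; map; reverse; filter; allFin)
open import Data.List.Properties using (unfold-reverse; map-cong; map-cong-local; map-∘)
open import Data.List.Membership.Propositional using (_∈_)
open import Data.List.Membership.Propositional.Properties using (∈-allFin; ∈-filter⁺; ∈-filter⁻; ∈-map⁺)
open import Data.List.Membership.Propositional.Properties.WithK using (unique∧set⇒bag)
open import Data.List.Relation.Binary.BagAndSetEquality using (∼bag⇒↭)
open import Data.List.Relation.Binary.Lex.Core using (Lex; base; halt; this; next)
open import Data.List.Relation.Binary.Lex.NonStrict using (<-irreflexive) renaming (≤-reflexive to ≤lex-reflexive)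
open import Data.List.Relation.Binary.Permutation.Propositional using (_↭_; ↭-sym; ↭-trans; ↭⇒↭ₛ)
open import Data.List.Relation.Binary.Permutation.Propositional.Properties using (All-resp-↭; ↭-reverse; ++-comm; map⁺)
open import Data.List.Relation.Binary.Pointwise using (Pointwise-≡⇒≡; ≡⇒Pointwise-≡)
open import Data.List.Relation.Unary.All as All using (All; []; _∷_)
open import Data.List.Relation.Unary.AllPairs using (AllPairs; []; _∷_)
import Data.List.Relation.Unary.AllPairs.Properties as AllPairs
open import Data.List.Relation.Unary.Any using (here; there)
open import Data.List.Relation.Unary.Linked.Properties using (AllPairs⇒Linked; Linked⇒AllPairs)
open import Data.List.Relation.Unary.Sorted.TotalOrder using (Sorted)
open import Data.List.Relation.Unary.Sorted.TotalOrder.Properties using (↗↭↗⇒≋)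
import Data.List.Relation.Unary.Unique.Propositional.Properties as Unique
import Data.List.Sort ≤-decTotalOrder as MergeSort
open import Data.Product using (_×_; _,_; proj₁; proj₂)
open import Data.Sum using (_⊎_; inj₁; inj₂)
open import Function using (_∘_; flip; id)
open import Function.Bundles using (_⇔_; mk⇔)
open import Function.Consequences.Propositional using (inverseᵇ⇒bijective; strictlyInverseˡ⇒inverseˡ; strictlyInverseʳ⇒inverseʳ)
import Function.Construct.Identity as Identity
open import Function.Definitions using (Bijective)
open import Relation.Binary.PropositionalEquality
open import Relation.Binary.Construct.NonStrictToStrict {A = ℕ} _≡_ _≤_ using () renaming (_<_ to _≺_)
open import Relation.Binary.Properties.DecTotalOrder ≤-decTotalOrder using (≥-decTotalOrder; ≥-totalOrder)
open import Data.List.Sort.InsertionSort.Base ≥-decTotalOrder using () renaming (insert to insertDesc; sort to sortDesc)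
open import Data.List.Sort.InsertionSort.Properties ≥-decTotalOrder using () renaming (sort-↭ to sortDesc-↭; sort-↗ to sortDesc-↘)
open import Relation.Nullary using (¬_; Dec; yes; no; ¬?)
open import Relation.Nullary.Decidable using (dec-true; dec-false; _×-dec_)

SortedDesc : List ℕ → Set
SortedDesc = Sorted ≥-totalOrder

-- Lexℕ ⊤ is _≤lex_ and Lexℕ ⊥ is its strict part.
Lexℕ : Set → List ℕ → List ℕ → Set
Lexℕ P = Lex P _≡_ _≺_

<⇒≺ : ∀ {x y} → x < y → x ≺ y
<⇒≺ x<y = <⇒≤ x<y , <⇒≢ x<y

AllPairs-reverse⁺ : ∀ {R : ℕ → ℕ → Set} {xs} → AllPairs R xs → AllPairs (flip R) (reverse xs)
AllPairs-reverse⁺ [] = []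
AllPairs-reverse⁺ {xs = x ∷ xs} (Rx ∷ Rxs) rewrite unfold-reverse x xs =
  AllPairs.++⁺ (AllPairs-reverse⁺ Rxs) ([] ∷ [])
    (All.map (_∷ []) (All-resp-↭ (↭-sym (↭-reverse xs)) Rx))

sortedDesc-↭-unique : ∀ {xs ys} → SortedDesc xs → SortedDesc ys → xs ↭ ys → xs ≡ ys
sortedDesc-↭-unique xs↘ ys↘ xs↭ys = Pointwise-≡⇒≡ (↗↭↗⇒≋ ≥-totalOrder xs↘ ys↘ (↭⇒↭ₛ xs↭ys))

reverse-sort≡sortDesc : ∀ xs → reverse (MergeSort.sort xs) ≡ sortDesc xs
reverse-sort≡sortDesc xs = sortedDesc-↭-unique
  (AllPairs⇒Linked (AllPairs-reverse⁺ (Linked⇒AllPairs ≤-trans (MergeSort.sort-↗ xs))))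
  (sortDesc-↘ xs)
  (↭-trans (↭-reverse _) (↭-trans (MergeSort.sort-↭ xs) (↭-sym (sortDesc-↭ xs))))

sortDesc-cong-↭ : ∀ {xs ys} → xs ↭ ys → sortDesc xs ≡ sortDesc ys
sortDesc-cong-↭ {xs} {ys} xs↭ys = sortedDesc-↭-unique (sortDesc-↘ xs) (sortDesc-↘ ys)
  (↭-trans (sortDesc-↭ xs) (↭-trans xs↭ys (↭-sym (sortDesc-↭ ys))))

insertDesc-here : ∀ {x y} ys → y ≤ x → insertDesc x (y ∷ ys) ≡ x ∷ y ∷ ys
insertDesc-here {x} {y} _ y≤x rewrite dec-true (y ≤? x) y≤x = refl

insertDesc-there : ∀ {x y} ys → x < y → insertDesc x (y ∷ ys) ≡ y ∷ insertDesc x ys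
insertDesc-there {x} {y} _ x<y rewrite dec-false (y ≤? x) (<⇒≱ x<y) = refl

insertDesc-lex : ∀ {P} z {xs ys} → Lexℕ P xs ys → Lexℕ P (insertDesc z xs) (insertDesc z ys)
insertDesc-lex z (base p) = next refl (base p)
insertDesc-lex z (halt {y} {ys}) with y ≤? z
... | yes y≤z rewrite insertDesc-here ys y≤z = next refl halt
... | no y≰z rewrite insertDesc-there ys (≰⇒> y≰z) = this (<⇒≺ (≰⇒> y≰z))
insertDesc-lex z (this {x} {xs} {y} {ys} x≺y) with x ≤? z | y ≤? z
... | yes x≤z | yes y≤z
  rewrite insertDesc-here xs x≤z | insertDesc-here ys y≤z = next refl (this x≺y)
... | yes x≤z | no y≰z
  rewrite insertDesc-here xs x≤z | insertDesc-there ys (≰⇒> y≰z) = this (<⇒≺ (≰⇒> y≰z))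
... | no x≰z  | yes y≤z = ⊥-elim (x≰z (≤-trans (proj₁ x≺y) y≤z))
... | no x≰z  | no y≰z
  rewrite insertDesc-there xs (≰⇒> x≰z) | insertDesc-there ys (≰⇒> y≰z) = this x≺y
insertDesc-lex z (next {x} {xs} {_} {ys} refl xs<ys) with x ≤? z
... | yes x≤z
  rewrite insertDesc-here xs x≤z | insertDesc-here ys x≤z = next refl (next refl xs<ys)
... | no x≰z
  rewrite insertDesc-there xs (≰⇒> x≰z) | insertDesc-there ys (≰⇒> x≰z) = next refl (insertDesc-lex z xs<ys)

sortDesc-++ˡ-lex : ∀ {P} zs {xs ys} → Lexℕ P (sortDesc xs) (sortDesc ys) →
                   Lexℕ P (sortDesc (zs ++ xs)) (sortDesc (zs ++ ys))
sortDesc-++ˡ-lex []       lex = lex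
sortDesc-++ˡ-lex (z ∷ zs) lex = insertDesc-lex z (sortDesc-++ˡ-lex zs lex)

sortDesc-pair-lex : ∀ {P x y z w} → x < z → y < z →
                    Lexℕ P (sortDesc (x ∷ y ∷ [])) (sortDesc (z ∷ w ∷ []))
sortDesc-pair-lex {x = x} {y} {z} {w} x<z y<z with y ≤? x | w ≤? z
... | yes y≤x | yes w≤z
  rewrite insertDesc-here [] y≤x | insertDesc-here [] w≤z = this (<⇒≺ x<z)
... | yes y≤x | no w≰z
  rewrite insertDesc-here [] y≤x | insertDesc-there [] (≰⇒> w≰z) = this (<⇒≺ (<-trans x<z (≰⇒> w≰z)))
... | no y≰x  | yes w≤z
  rewrite insertDesc-there [] (≰⇒> y≰x) | insertDesc-here [] w≤z = this (<⇒≺ y<z)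
... | no y≰x  | no w≰z
  rewrite insertDesc-there [] (≰⇒> y≰x) | insertDesc-there [] (≰⇒> w≰z) = this (<⇒≺ (<-trans y<z (≰⇒> w≰z)))

sortDesc-replace-pair-lex : ∀ {P x y z w} zs → x < z → y < z →
                            Lexℕ P (sortDesc (x ∷ y ∷ zs)) (sortDesc (z ∷ w ∷ zs))
sortDesc-replace-pair-lex {P} {x} {y} {z} {w} zs x<z y<z =
  subst₂ (Lexℕ P) (sortDesc-cong-↭ (++-comm zs (x ∷ y ∷ []))) (sortDesc-cong-↭ (++-comm zs (z ∷ w ∷ [])))
    (sortDesc-++ˡ-lex zs (sortDesc-pair-lex x<z y<z))

+-mono-≤-≡⇒≡ : ∀ {p q r s} → p ≤ q → r ≤ s → p + r ≡ q + s → p ≡ q × r ≡ s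
+-mono-≤-≡⇒≡ {p} {q} {r} {s} p≤q r≤s eq =
  ≤-antisym p≤q (+-cancelʳ-≤ r q p (≤-trans (+-monoʳ-≤ q r≤s) (≤-reflexive (sym eq)))) ,
  ≤-antisym r≤s (+-cancelˡ-≤ p s r (≤-trans (+-monoˡ-≤ s p≤q) (≤-reflexive (sym eq))))

sum-map-mono : ∀ {A : Set} {f g : A → ℕ} → (∀ x → f x ≤ g x) → ∀ xs → sum (map f xs) ≤ sum (map g xs)
sum-map-mono f≤g []       = z≤n
sum-map-mono f≤g (x ∷ xs) = +-mono-≤ (f≤g x) (sum-map-mono f≤g xs)

sum-map-mono-≡⇒≡ : ∀ {A : Set} {f g : A → ℕ} → (∀ x → f x ≤ g x) →
                   ∀ xs → sum (map f xs) ≡ sum (map g xs) → All (λ x → f x ≡ g x) xs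
sum-map-mono-≡⇒≡ f≤g []       _  = []
sum-map-mono-≡⇒≡ f≤g (x ∷ xs) eq with +-mono-≤-≡⇒≡ (f≤g x) (sum-map-mono f≤g xs) eq
... | fx≡gx , rest≡ = fx≡gx ∷ sum-map-mono-≡⇒≡ f≤g xs rest≡

ind-∨ˡ : ∀ x y → ind x ≤ ind (x ∨ y)
ind-∨ˡ true  _ = ≤-refl
ind-∨ˡ false _ = z≤n

ind-∨+ind-∧ : ∀ x y → ind (x ∨ y) + ind (x ∧ y) ≡ ind x + ind y
ind-∨+ind-∧ true  true  = refl
ind-∨+ind-∧ true  false = refl
ind-∨+ind-∧ false true  = refl
ind-∨+ind-∧ false false = refl

ind-≡-∨⇒ : ∀ x y → ind x ≡ ind (x ∨ y) → y ≡ true → x ≡ true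
ind-≡-∨⇒ true  _    _  _    = refl
ind-≡-∨⇒ false true () refl

implied⇒∨≡ˡ : ∀ {x y} → (y ≡ true → x ≡ true) → x ∨ y ≡ x
implied⇒∨≡ˡ {true}          _   = refl
implied⇒∨≡ˡ {false} {true}  y⇒x = sym (y⇒x refl)
implied⇒∨≡ˡ {false} {false} _   = refl

implied⇒∧≡ʳ : ∀ {x y} → (y ≡ true → x ≡ true) → x ∧ y ≡ y
implied⇒∧≡ʳ {true}          _   = refl
implied⇒∧≡ʳ {false} {true}  y⇒x = y⇒x refl
implied⇒∧≡ʳ {false} {false} _   = refl

data Role {n} (a b : Fin n) : Fin n → Set where
  is-a : Role a b a
  is-b : Role a b b
  off  : ∀ {x} → x ≢ a → x ≢ b → Role a b x

role : ∀ {n} (a b x : Fin n) → Role a b x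
role a b x with x ≟ a | x ≟ b
... | yes refl | _        = is-a
... | no _     | yes refl = is-b
... | no x≢a   | no x≢b   = off x≢a x≢b

avoids? : ∀ {n} (a b v : Fin n) → Dec (v ≢ a × v ≢ b)
avoids? a b v = ¬? (v ≟ a) ×-dec ¬? (v ≟ b)

othersThan : ∀ {n} → Fin n → Fin n → List (Fin n)
othersThan a b = filter (avoids? a b) (allFin _)

∈-othersThan⁻ : ∀ {n} {a b v : Fin n} → v ∈ othersThan a b → v ≢ a × v ≢ b
∈-othersThan⁻ {a = a} {b} = proj₂ ∘ ∈-filter⁻ (avoids? a b) {xs = allFin _}

allFin-↭-pair : ∀ {n} {a b : Fin n} → a ≢ b → allFin n ↭ a ∷ b ∷ othersThan a b
allFin-↭-pair {n} {a} {b} a≢b =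
  ∼bag⇒↭ (unique∧set⇒bag (Unique.allFin⁺ n) unique (mk⇔ into (λ _ → ∈-allFin _)))
  where
  unique = (a≢b ∷ All.tabulate (≢-sym ∘ proj₁ ∘ ∈-othersThan⁻))
         ∷ All.tabulate (≢-sym ∘ proj₂ ∘ ∈-othersThan⁻)
         ∷ Unique.filter⁺ (avoids? a b) (Unique.allFin⁺ n)
  into : ∀ {v} → v ∈ allFin n → v ∈ a ∷ b ∷ othersThan a b
  into {v} _ with role a b v
  ... | is-a        = here refl
  ... | is-b        = there (here refl)
  ... | off v≢a v≢b = there (there (∈-filter⁺ (avoids? a b) (∈-allFin v) (v≢a , v≢b)))

allFin-↭-bijection : ∀ {n} {σ : Fin n → Fin n} → Bijective _≡_ _≡_ σ → map σ (allFin n) ↭ allFin n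
allFin-↭-bijection {n} {σ} (inj , surj) =
  ∼bag⇒↭ (unique∧set⇒bag (Unique.map⁺ inj (Unique.allFin⁺ n)) (Unique.allFin⁺ n) (mk⇔ (λ _ → ∈-allFin _) onto))
  where
  onto : ∀ {v} → v ∈ allFin n → v ∈ map σ (allFin n)
  onto {v} _ with surj v
  ... | u , σu≡v = subst (_∈ map σ (allFin n)) (σu≡v refl) (∈-map⁺ σ (∈-allFin u))

∑ : ∀ {n} → (Fin n → ℕ) → ℕ
∑ {n} f = sum (map f (allFin n))

∑-cong : ∀ {n} {f g : Fin n → ℕ} → (∀ v → f v ≡ g v) → ∑ f ≡ ∑ g
∑-cong {n} f≡g = cong sum (map-cong f≡g (allFin n))

∑-∘-bijection : ∀ {n} {σ : Fin n → Fin n} → Bijective _≡_ _≡_ σ → ∀ f → ∑ (f ∘ σ) ≡ ∑ f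
∑-∘-bijection {n} bij f = trans (cong sum (map-∘ (allFin n))) (sum-↭ (map⁺ f (allFin-↭-bijection bij)))

∑-cong-off-pair : ∀ {n} {a b : Fin n} {f g : Fin n → ℕ} → a ≢ b →
                  (∀ {v} → v ≢ a → v ≢ b → f v ≡ g v) → f a + f b ≡ g a + g b → ∑ f ≡ ∑ g
∑-cong-off-pair {a = a} {b} {f} {g} a≢b off≡ pair≡ = begin
  ∑ f                   ≡⟨ split f ⟩
  f a + (f b + rest f)  ≡⟨ +-assoc (f a) _ _ ⟨
  (f a + f b) + rest f  ≡⟨ cong₂ _+_ pair≡ rest≡ ⟩
  (g a + g b) + rest g  ≡⟨ +-assoc (g a) _ _ ⟩
  g a + (g b + rest g)  ≡⟨ split g ⟨
  ∑ g                   ∎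
  where
  open ≡-Reasoning
  rest : (Fin _ → ℕ) → ℕ
  rest h = sum (map h (othersThan a b))
  split : ∀ h → ∑ h ≡ h a + (h b + rest h)
  split h = sum-↭ (map⁺ h (allFin-↭-pair a≢b))
  rest≡ : rest f ≡ rest g
  rest≡ = cong sum (map-cong-local (All.tabulate λ v∈ → let v≢a , v≢b = ∈-othersThan⁻ v∈ in off≡ v≢a v≢b))

∑-mono : ∀ {n} {f g : Fin n → ℕ} → (∀ v → f v ≤ g v) → ∑ f ≤ ∑ g
∑-mono {n} f≤g = sum-map-mono f≤g (allFin n)

∑-mono-≡⇒≡ : ∀ {n} {f g : Fin n → ℕ} → (∀ v → f v ≤ g v) → ∑ f ≡ ∑ g → ∀ v → f v ≡ g v
∑-mono-≡⇒≡ {n} f≤g eq v = All.lookup (sum-map-mono-≡⇒≡ f≤g (allFin n) eq) (∈-allFin v)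

degree-preserved : ∀ {n} {A B : Adj n} {σ} → IsIsoMap A B σ → ∀ i → degree A i ≡ degree B (σ i)
degree-preserved {B = B} {σ} (bij , A≡B) i = cong₂ _+_
  (trans (∑-cong (λ v → cong ind (A≡B i v))) (∑-∘-bijection bij (λ w → ind (B (σ i) w))))
  (trans (∑-cong (λ v → cong ind (A≡B v i))) (∑-∘-bijection bij (λ w → ind (B w (σ i)))))

isomorphic⇒degSeq≡ : ∀ {n} {A B : Adj n} → Isomorphic A B → degSeq A ≡ degSeq B
isomorphic⇒degSeq≡ {n} {A} {B} (σ , iso@(bij , _)) = begin
  degSeq A                                      ≡⟨ reverse-sort≡sortDesc _ ⟩
  sortDesc (map (degree A) (allFin n))          ≡⟨ cong sortDesc (map-cong (degree-preserved {A = A} {B} iso) (allFin n)) ⟩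
  sortDesc (map (degree B ∘ σ) (allFin n))      ≡⟨ cong sortDesc (map-∘ (allFin n)) ⟩
  sortDesc (map (degree B) (map σ (allFin n)))  ≡⟨ sortDesc-cong-↭ (map⁺ (degree B) (allFin-↭-bijection bij)) ⟩
  sortDesc (map (degree B) (allFin n))          ≡⟨ reverse-sort≡sortDesc _ ⟨
  degSeq B                                      ∎
  where open ≡-Reasoning

degSeq-split : ∀ {n} (A : Adj n) {a b : Fin n} → a ≢ b →
               degSeq A ≡ sortDesc (degree A a ∷ degree A b ∷ map (degree A) (othersThan a b))
degSeq-split A a≢b = trans (reverse-sort≡sortDesc _) (sortDesc-cong-↭ (map⁺ (degree A) (allFin-↭-pair a≢b)))

module _ {n} {a b : Fin n} (a≢b : a ≢ b) where

  swapAB-a : swapAB a b a ≡ b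
  swapAB-a rewrite ≢-≟-identity _≟_ a≢b | ≡-≟-identity _≟_ (refl {x = a}) = refl

  swapAB-b : swapAB a b b ≡ a
  swapAB-b rewrite ≡-≟-identity _≟_ (refl {x = b}) = refl

  swapAB-off : ∀ {x} → x ≢ a → x ≢ b → swapAB a b x ≡ x
  swapAB-off x≢a x≢b rewrite ≢-≟-identity _≟_ x≢b | ≢-≟-identity _≟_ x≢a = refl

  swapAB-involutive : ∀ x → swapAB a b (swapAB a b x) ≡ x
  swapAB-involutive x with role a b x
  ... | is-a        = trans (cong (swapAB a b) swapAB-a) swapAB-b
  ... | is-b        = trans (cong (swapAB a b) swapAB-b) swapAB-a
  ... | off x≢a x≢b = trans (cong (swapAB a b) (swapAB-off x≢a x≢b)) (swapAB-off x≢a x≢b)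

  swapAB-bijective : Bijective _≡_ _≡_ (swapAB a b)
  swapAB-bijective = inverseᵇ⇒bijective
    ( strictlyInverseˡ⇒inverseˡ {f⁻¹ = swapAB a b} (swapAB a b) swapAB-involutive
    , strictlyInverseʳ⇒inverseʳ {f⁻¹ = swapAB a b} (swapAB a b) swapAB-involutive)

module KelmansEntries {n} (A : Adj n) {a b : Fin n} (a≢b : a ≢ b) where

  private
    K = kelmans A a b
    a≟a = ≡-≟-identity _≟_ (refl {x = a})
    b≟b = ≡-≟-identity _≟_ (refl {x = b})
    b≟a = ≢-≟-identity _≟_ (≢-sym a≢b)

  a-a : K a a ≡ A a a
  a-a rewrite a≟a = refl

  a-b : K a b ≡ A a b
  a-b rewrite a≟a | b≟a | b≟b = refl

  a-off : ∀ {j} → j ≢ a → j ≢ b → K a j ≡ A a j ∨ A b j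
  a-off j≢a j≢b rewrite a≟a | ≢-≟-identity _≟_ j≢a | ≢-≟-identity _≟_ j≢b = refl

  b-a : K b a ≡ A b a
  b-a rewrite b≟a | b≟b | a≟a = refl

  b-b : K b b ≡ A b b
  b-b rewrite b≟a | b≟b = refl

  b-off : ∀ {j} → j ≢ a → j ≢ b → K b j ≡ A a j ∧ A b j
  b-off j≢a j≢b rewrite b≟a | b≟b | ≢-≟-identity _≟_ j≢a | ≢-≟-identity _≟_ j≢b = refl

  off-a : ∀ {i} → i ≢ a → i ≢ b → K i a ≡ A i a ∨ A i b
  off-a i≢a i≢b rewrite ≢-≟-identity _≟_ i≢a | ≢-≟-identity _≟_ i≢b | a≟a = refl

  off-b : ∀ {i} → i ≢ a → i ≢ b → K i b ≡ A i a ∧ A i b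
  off-b i≢a i≢b rewrite ≢-≟-identity _≟_ i≢a | ≢-≟-identity _≟_ i≢b | b≟a | b≟b = refl

  off-off : ∀ {i j} → i ≢ a → i ≢ b → j ≢ a → j ≢ b → K i j ≡ A i j
  off-off i≢a i≢b j≢a j≢b
    rewrite ≢-≟-identity _≟_ i≢a | ≢-≟-identity _≟_ i≢b
          | ≢-≟-identity _≟_ j≢a | ≢-≟-identity _≟_ j≢b = refl

kelmans-swap-iso : ∀ {n} (G : MixedGraph n) {a b : Fin n} → a ≢ b → NoArc (adj G) a b →
                   IsIsoMap (kelmansG G a b) (kelmansG G b a) (swapAB a b)
kelmans-swap-iso G {a} {b} a≢b ab≡ba = swapAB-bijective a≢b , entries
  where
  A = adj G
  module Kab = KelmansEntries A a≢b
  module Kba = KelmansEntries A (≢-sym a≢b)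
  aa≡bb : A a a ≡ A b b
  aa≡bb = trans (loopless G a) (sym (loopless G b))
  entries : ∀ i j → kelmans A a b i j ≡ kelmans A b a (swapAB a b i) (swapAB a b j)
  entries i j with role a b i | role a b j
  ... | is-a | is-a
    rewrite swapAB-a a≢b = trans Kab.a-a (trans aa≡bb (sym Kba.a-a))
  ... | is-a | is-b
    rewrite swapAB-a a≢b | swapAB-b a≢b = trans Kab.a-b (trans ab≡ba (sym Kba.a-b))
  ... | is-a | off j≢a j≢b
    rewrite swapAB-a a≢b | swapAB-off a≢b j≢a j≢b =
    trans (Kab.a-off j≢a j≢b) (trans (∨-comm (A a j) (A b j)) (sym (Kba.a-off j≢b j≢a)))
  ... | is-b | is-a
    rewrite swapAB-a a≢b | swapAB-b a≢b = trans Kab.b-a (trans (sym ab≡ba) (sym Kba.b-a))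
  ... | is-b | is-b
    rewrite swapAB-b a≢b = trans Kab.b-b (trans (sym aa≡bb) (sym Kba.b-b))
  ... | is-b | off j≢a j≢b
    rewrite swapAB-b a≢b | swapAB-off a≢b j≢a j≢b =
    trans (Kab.b-off j≢a j≢b) (trans (∧-comm (A a j) (A b j)) (sym (Kba.b-off j≢b j≢a)))
  ... | off i≢a i≢b | is-a
    rewrite swapAB-a a≢b | swapAB-off a≢b i≢a i≢b =
    trans (Kab.off-a i≢a i≢b) (trans (∨-comm (A i a) (A i b)) (sym (Kba.off-a i≢b i≢a)))
  ... | off i≢a i≢b | is-b
    rewrite swapAB-b a≢b | swapAB-off a≢b i≢a i≢b =
    trans (Kab.off-b i≢a i≢b) (trans (∧-comm (A i a) (A i b)) (sym (Kba.off-b i≢b i≢a)))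
  ... | off i≢a i≢b | off j≢a j≢b
    rewrite swapAB-off a≢b i≢a i≢b | swapAB-off a≢b j≢a j≢b =
    trans (Kab.off-off i≢a i≢b j≢a j≢b) (sym (Kba.off-off i≢b i≢a j≢b j≢a))

Dominated : ∀ {n} → Adj n → Fin n → Fin n → Set
Dominated A u v = OutSub A u v v u × InSub A u v v u

module _ {n} (A : Adj n) {a b : Fin n} (a≢b : a ≢ b) where

  open KelmansEntries A a≢b

  private
    K = kelmans A a b

  dominated⇒kelmans-fixes : Dominated A b a → ∀ i j → A i j ≡ K i j
  dominated⇒kelmans-fixes (out⊆ , in⊆) i j with role a b i | role a b j
  ... | is-a        | is-a        = sym a-a
  ... | is-a        | is-b        = sym a-b
  ... | is-a        | off j≢a j≢b = sym (trans (a-off j≢a j≢b) (implied⇒∨≡ˡ λ bj → proj₁ (out⊆ j bj j≢a)))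
  ... | is-b        | is-a        = sym b-a
  ... | is-b        | is-b        = sym b-b
  ... | is-b        | off j≢a j≢b = sym (trans (b-off j≢a j≢b) (implied⇒∧≡ʳ λ bj → proj₁ (out⊆ j bj j≢a)))
  ... | off i≢a i≢b | is-a        = sym (trans (off-a i≢a i≢b) (implied⇒∨≡ˡ λ ib → proj₁ (in⊆ i ib i≢a)))
  ... | off i≢a i≢b | is-b        = sym (trans (off-b i≢a i≢b) (implied⇒∧≡ʳ λ ib → proj₁ (in⊆ i ib i≢a)))
  ... | off i≢a i≢b | off j≢a j≢b = sym (off-off i≢a i≢b j≢a j≢b)

  kelmans-degree-off : ∀ {i} → i ≢ a → i ≢ b → degree K i ≡ degree A i
  kelmans-degree-off {i} i≢a i≢b = cong₂ _+_
    (∑-cong-off-pair a≢b (λ j≢a j≢b → cong ind (off-off i≢a i≢b j≢a j≢b))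
      (trans (cong₂ _+_ (cong ind (off-a i≢a i≢b)) (cong ind (off-b i≢a i≢b))) (ind-∨+ind-∧ (A i a) (A i b))))
    (∑-cong-off-pair a≢b (λ j≢a j≢b → cong ind (off-off j≢a j≢b i≢a i≢b))
      (trans (cong₂ _+_ (cong ind (a-off i≢a i≢b)) (cong ind (b-off i≢a i≢b))) (ind-∨+ind-∧ (A a i) (A b i))))

  kelmans-row-a-≥ : ∀ v → ind (A a v) ≤ ind (K a v)
  kelmans-row-a-≥ v with role a b v
  ... | is-a        = ≤-reflexive (cong ind (sym a-a))
  ... | is-b        = ≤-reflexive (cong ind (sym a-b))
  ... | off v≢a v≢b = subst (ind (A a v) ≤_) (cong ind (sym (a-off v≢a v≢b))) (ind-∨ˡ _ _)

  kelmans-column-a-≥ : ∀ v → ind (A v a) ≤ ind (K v a)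
  kelmans-column-a-≥ v with role a b v
  ... | is-a        = ≤-reflexive (cong ind (sym a-a))
  ... | is-b        = ≤-reflexive (cong ind (sym b-a))
  ... | off v≢a v≢b = subst (ind (A v a) ≤_) (cong ind (sym (off-a v≢a v≢b))) (ind-∨ˡ _ _)

  kelmans-degree-a-≥ : degree A a ≤ degree K a
  kelmans-degree-a-≥ = +-mono-≤ (∑-mono kelmans-row-a-≥) (∑-mono kelmans-column-a-≥)

  kelmans-degree-a-≡⇒dominated : A b b ≡ false → degree K a ≡ degree A a → Dominated A b a
  kelmans-degree-a-≡⇒dominated bb≡false eq = out⊆ , in⊆
    where
    row-and-column≡ = +-mono-≤-≡⇒≡ (∑-mono kelmans-row-a-≥) (∑-mono kelmans-column-a-≥) (sym eq)
    row≡ : ∀ v → ind (A a v) ≡ ind (K a v)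
    row≡ = ∑-mono-≡⇒≡ kelmans-row-a-≥ (proj₁ row-and-column≡)
    column≡ : ∀ v → ind (A v a) ≡ ind (K v a)
    column≡ = ∑-mono-≡⇒≡ kelmans-column-a-≥ (proj₂ row-and-column≡)
    bb≢true : A b b ≢ true
    bb≢true bb≡true with trans (sym bb≡false) bb≡true
    ... | ()
    out⊆ : OutSub A b a a b
    out⊆ x bx x≢a = ind-≡-∨⇒ _ _ (trans (row≡ x) (cong ind (a-off x≢a x≢b))) bx , x≢b
      where
      x≢b : x ≢ b
      x≢b refl = bb≢true bx
    in⊆ : InSub A b a a b
    in⊆ x xb x≢a = ind-≡-∨⇒ _ _ (trans (column≡ x) (cong ind (off-a x≢a x≢b))) xb , x≢b
      where
      x≢b : x ≢ b
      x≢b refl = bb≢true xb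

module KelmansComparison {n} (G : MixedGraph n) {a b : Fin n} (a≢b : a ≢ b) (ab≡ba : NoArc (adj G) a b) where

  private
    A = adj G
    K = kelmans A a b
    b≢a = ≢-sym a≢b

  degree-kelmans-swapped : degree (kelmans A b a) b ≡ degree K a
  degree-kelmans-swapped = trans
    (degree-preserved {A = kelmans A b a} {K} (kelmans-swap-iso G b≢a (sym ab≡ba)) b)
    (cong (degree K) (swapAB-a b≢a))

  kelmans-degree-b-≤ : degree A b ≤ degree K a
  kelmans-degree-b-≤ = subst (degree A b ≤_) degree-kelmans-swapped (kelmans-degree-a-≥ A b≢a)

  kelmans-degree-b-≡⇒dominated : degree K a ≡ degree A b → Dominated A a b
  kelmans-degree-b-≡⇒dominated eq =
    kelmans-degree-a-≡⇒dominated A b≢a (loopless G a) (trans degree-kelmans-swapped eq)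

  dominated⇒isomorphic : Dominated A a b ⊎ Dominated A b a → Isomorphic A K
  dominated⇒isomorphic (inj₁ a⊑b) = swapAB b a , swapAB-bijective b≢a , λ i j →
    trans (dominated⇒kelmans-fixes A b≢a a⊑b i j) (proj₂ (kelmans-swap-iso G b≢a (sym ab≡ba)) i j)
  dominated⇒isomorphic (inj₂ b⊑a) = id , Identity.bijective _≡_ , dominated⇒kelmans-fixes A a≢b b⊑a

  degSeq-kelmans : degSeq K ≡ sortDesc (degree K a ∷ degree K b ∷ map (degree A) (othersThan a b))
  degSeq-kelmans = trans (degSeq-split K a≢b)
    (cong (λ ds → sortDesc (degree K a ∷ degree K b ∷ ds)) (map-cong-local
      (All.tabulate λ v∈ → let v≢a , v≢b = ∈-othersThan⁻ v∈ in kelmans-degree-off A a≢b v≢a v≢b)))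

  dominated-or-degSeq-lex : ∀ {P} → (Dominated A a b ⊎ Dominated A b a) ⊎ Lexℕ P (degSeq A) (degSeq K)
  dominated-or-degSeq-lex {P} with degree K a ℕ.≟ degree A a | degree K a ℕ.≟ degree A b
  ... | yes eq | _      = inj₁ (inj₂ (kelmans-degree-a-≡⇒dominated A a≢b (loopless G b) eq))
  ... | no _   | yes eq = inj₁ (inj₁ (kelmans-degree-b-≡⇒dominated eq))
  ... | no ≢a  | no ≢b  = inj₂ (subst₂ (Lexℕ P) (sym (degSeq-split A a≢b)) (sym degSeq-kelmans)
    (sortDesc-replace-pair-lex (map (degree A) (othersThan a b))
      (≤∧≢⇒< (kelmans-degree-a-≥ A a≢b) (≢a ∘ sym)) (≤∧≢⇒< kelmans-degree-b-≤ (≢b ∘ sym))))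

  degSeq≡⇒dominated : degSeq K ≡ degSeq A → Dominated A a b ⊎ Dominated A b a
  degSeq≡⇒dominated eq with dominated-or-degSeq-lex {⊥}
  ... | inj₁ dominated = dominated
  ... | inj₂ A<K       = ⊥-elim (<-irreflexive (≡⇒Pointwise-≡ (sym eq)) A<K)

  degSeq-lex : degSeq A ≤lex degSeq K
  degSeq-lex with dominated-or-degSeq-lex {⊤}
  ... | inj₁ dominated =
    ≤lex-reflexive _≡_ _≤_ (≡⇒Pointwise-≡ (isomorphic⇒degSeq≡ (dominated⇒isomorphic dominated)))
  ... | inj₂ A≤K = A≤K

lemma2p2 : ∀ {n} (G : MixedGraph n) (a b : Fin n) → ¬ a ≡ b → NoArc (adj G) a b →
  IsIsoMap (kelmansG G a b) (kelmansG G b a) (swapAB a b)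
  × (degSeq (adj G) ≤lex degSeq (kelmansG G a b))
  × ((degSeq (kelmansG G a b) ≡ degSeq (adj G)) ⇔ Isomorphic (adj G) (kelmansG G a b))
  × (Isomorphic (adj G) (kelmansG G a b)
       ⇔ ((OutSub (adj G) a b b a × InSub (adj G) a b b a)
          ⊎ (OutSub (adj G) b a a b × InSub (adj G) b a a b)))
lemma2p2 G a b a≢b ab≡ba =
  kelmans-swap-iso G a≢b ab≡ba ,
  degSeq-lex ,
  mk⇔ (dominated⇒isomorphic ∘ degSeq≡⇒dominated) (sym ∘ isomorphic⇒degSeq≡) ,
  mk⇔ (degSeq≡⇒dominated ∘ sym ∘ isomorphic⇒degSeq≡) dominated⇒isomorphic
  where open KelmansComparison G a≢b ab≡ba
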